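{- Let $G$ be a finite abelian group that is not cyclic, and let $i_0$ be the largest $i$ with $X_i\ne\varnothing$. Then $X_{i_0}$ is not a clique in the power graph $\mathfrak{g}(G)$.
   Context: The power graph $\mathfrak{g}(G)$ has vertex set $G$, distinct $x,y$ adjacent iff $\langle x\rangle\le\langle y\rangle$ or $\langle y\rangle\le\langle x\rangle$. The composition length of a finite group is the length (number of proper inclusions) of a composition series. For each $i$, $X_i$ denotes the set of elements $x\in G$ such that the cyclic subgroup $\langle x\rangle$ has composition length $i$. A clique is a set of pairwise adjacent vertices. -}

module Defs where

open import Level using (Level; _⊔_) renaming (suc to lsuc)
open import Algebra.Bundles using (AbelianGroup)
open import Data.Nat using (ℕ; zero; suc; _<_)
open import Data.Integer using (ℤ; +_; -[1+_])
open import Data.Fin using (Fin; fromℕ; inject₁) renaming (zero to fzero; suc to fsuc)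
open import Data.Product using (Σ; ∃; _×_; _,_)
open import Data.Sum using (_⊎_)
open import Relation.Nullary using (¬_)
open import Relation.Unary using (Pred; _⊆_; _∈_)

module _ {c ℓ : Level} (G : AbelianGroup c ℓ) where
  open AbelianGroup G

  powℕ : Carrier → ℕ → Carrier
  powℕ x zero    = ε
  powℕ x (suc n) = x ∙ powℕ x n

  powℤ : Carrier → ℤ → Carrier
  powℤ x (+ n)      = powℕ x n
  powℤ x -[1+ n ]   = (powℕ x (suc n)) ⁻¹

  ⟨_⟩ : Carrier → Pred Carrier ℓ
  ⟨ x ⟩ y = ∃ λ (k : ℤ) → y ≈ powℤ x k

  IsFinite : Set (c ⊔ ℓ)
  IsFinite = Σ ℕ λ n → Σ (Fin n → Carrier) λ enum → ∀ x → ∃ λ i → enum i ≈ x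

  IsCyclic : Set (c ⊔ ℓ)
  IsCyclic = ∃ λ g → ∀ y → y ∈ ⟨ g ⟩

  record IsSubgroup (H : Pred Carrier (c ⊔ ℓ)) : Set (c ⊔ ℓ) where
    field
      resp  : ∀ {x y} → x ≈ y → H x → H y
      ε∈    : H ε
      ∙-closed : ∀ {x y} → H x → H y → H (x ∙ y)
      ⁻¹-closed : ∀ {x} → H x → H (x ⁻¹)

  _≐_ : ∀ {a b} → Pred Carrier a → Pred Carrier b → Set (c ⊔ a ⊔ b)
  A ≐ B = (A ⊆ B) × (B ⊆ A)

  _⊂_ : Pred Carrier (c ⊔ ℓ) → Pred Carrier (c ⊔ ℓ) → Set (c ⊔ ℓ)
  A ⊂ B = (A ⊆ B) × ∃ λ y → B y × ¬ A y

  Trivial : Pred Carrier ℓ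
  Trivial y = y ≈ ε

  -- A composition series of length k of the subgroup ⟨x⟩:
  -- {ε} = H₀ < H₁ < … < H_k = ⟨x⟩, all subgroups, each factor H_{j+1}/H_j simple.
  -- Since G is abelian, every H_j is normal in H_{j+1}, and by the correspondence
  -- theorem H_{j+1}/H_j is simple iff H_j ⊊ H_{j+1} with no subgroup strictly between.
  record CompositionSeries (x : Carrier) (k : ℕ) : Set (lsuc (c ⊔ ℓ)) where
    field
      H        : Fin (suc k) → Pred Carrier (c ⊔ ℓ)
      subgroup : ∀ j → IsSubgroup (H j)
      bottom   : H fzero ≐ Trivial
      top      : H (fromℕ k) ≐ ⟨ x ⟩
      proper   : ∀ (j : Fin k) → H (inject₁ j) ⊂ H (fsuc j)
      maximal  : ∀ (j : Fin k) (K : Pred Carrier (c ⊔ ℓ)) → IsSubgroup K →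
                 ¬ ((H (inject₁ j) ⊂ K) × (K ⊂ H (fsuc j)))

  X : ℕ → Pred Carrier (lsuc (c ⊔ ℓ))
  X i x = CompositionSeries x i

  Adjacent : Carrier → Carrier → Set (c ⊔ ℓ)
  Adjacent x y = (¬ x ≈ y) × ((⟨ x ⟩ ⊆ ⟨ y ⟩) ⊎ (⟨ y ⟩ ⊆ ⟨ x ⟩))

  IsClique : ∀ {a} → Pred Carrier a → Set (c ⊔ ℓ ⊔ a)
  IsClique S = ∀ x y → S x → S y → ¬ x ≈ y → Adjacent x y

-- Fix x ∈ X i₀ and suppose X i₀ is a clique.  Since G is not cyclic there is z ∉ ⟨x⟩, and
-- stripping prime factors off the order of z yields w ∉ ⟨x⟩ with w ^ p = x ^ k for a prime p.
-- If p ∤ k (or p ∤ k + |x|), a Bézout combination gives v ∉ ⟨x⟩ with v ^ p = x; then ⟨x⟩ has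
-- prime index in ⟨v⟩, so a composition series of ⟨x⟩ extends to one of ⟨v⟩ of length i₀ + 1,
-- contradicting the maximality of i₀.  Otherwise p divides both k and |x|, and u = w x^(-k/p)
-- has order p and lies outside ⟨x⟩.  Then y = x u has the same annihilator as x, so
-- x ^ m ↦ y ^ m is an isomorphism ⟨x⟩ ≅ ⟨y⟩ carrying composition series along, and y ∈ X i₀;
-- but neither of ⟨x⟩, ⟨y⟩ contains the other, so x and y are not adjacent.
-- The classical steps (choosing z, taking the order of x) are done under double negation.

module Submission where

open import Defs
open import Level using (Level; _⊔_; Lift; lift; lower) renaming (suc to lsuc)
open import Algebra.Bundles using (AbelianGroup)
open import Data.Nat using (ℕ; zero; suc; _+_; _*_; _<_)
open import Data.Nat.Properties
  using (*-comm; *-suc; +-comm; +-suc; ≤-refl; ≤-pred; n<1+n; m≤n⇒∃[o]m+o≡n)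
open import Data.Nat.Divisibility
  using (_∣_; _∣?_; divides; ∣1⇒≡1; ∣m+n∣m⇒∣n; ∣-trans; n∣m*n; m∣m*n; m%n≡0⇒n∣m)
open import Data.Nat.DivMod using (_%_; _/_; m≡m%n+[m/n]*n; m%n<n)
open import Data.Nat.Coprimality using (Coprime; coprime-Bézout)
open import Data.Nat.GCD using (module Bézout)
open import Data.Nat.Induction using (<-wellFounded)
open import Data.Nat.ListAction using (product)
open import Data.Nat.Primality using (Prime; prime⇒irreducible; ¬prime[1])
open import Data.Nat.Primality.Factorisation using (factorise; PrimeFactorisation)
open import Data.List using ([]; _∷_)
open import Data.List.Relation.Unary.All using (All; []; _∷_)
open import Data.Fin using (Fin; fromℕ; inject₁; toℕ) renaming (zero to fzero; suc to fsuc)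
open import Data.Fin.Properties using (pigeonhole)
open import Data.Fin.Relation.Unary.Top
  using (View; view; ‵fromℕ; ‵inject₁; view-fromℕ; view-inject₁)
open import Data.Integer using (+_; -[1+_])
open import Data.Product using (∃; _×_; _,_; proj₁; proj₂)
open import Data.Sum using (inj₁; inj₂)
open import Data.Empty using (⊥; ⊥-elim)
open import Induction.WellFounded using (Acc; acc)
open import Relation.Nullary using (¬_; yes; no)
open import Relation.Nullary.Decidable using (¬¬-excluded-middle)
open import Relation.Unary using (Pred; _⊆_)
open import Relation.Binary.PropositionalEquality as ≡ using (_≡_)

prime∤⇒coprime : ∀ {p a} → Prime p → ¬ p ∣ a → Coprime p a
prime∤⇒coprime pp p∤a (d∣p , d∣a) with prime⇒irreducible pp d∣p
... | inj₁ d≡1 = d≡1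
... | inj₂ ≡.refl = ⊥-elim (p∤a d∣a)

prime∤1 : ∀ {p} → Prime p → ¬ p ∣ 1
prime∤1 pp p∣1 with ∣1⇒≡1 p∣1
... | ≡.refl = ¬prime[1] pp

prime∤1+ : ∀ {p a b} → Prime p → p ∣ a → p ∣ b → 1 + a ≡ b → ⊥
prime∤1+ {p} {a} pp p∣a p∣b 1+a≡b =
  prime∤1 pp (∣m+n∣m⇒∣n (≡.subst (p ∣_) (≡.trans (≡.sym 1+a≡b) (+-comm 1 a)) p∣b) p∣a)

¬¬-least : ∀ {p} (P : Pred ℕ p) {n} → Acc _<_ n → P n →
           ¬ ¬ ∃ λ m → P m × (∀ k → k < m → ¬ P k)
¬¬-least P {n} (acc smaller) Pn ¬least = ¬¬-excluded-middle {A = ∃ λ m → m < n × P m} λ where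
  (yes (m , m<n , Pm)) → ¬¬-least P (smaller m<n) Pm ¬least
  (no ∄below)          → ¬least (n , Pn , λ k k<n Pk → ∄below (k , k<n , Pk))

¬¬-∀-Fin : ∀ {p} n {P : Fin n → Set p} → (∀ i → ¬ ¬ P i) → ¬ ¬ (∀ i → P i)
¬¬-∀-Fin zero    _  ¬∀ = ¬∀ λ ()
¬¬-∀-Fin (suc n) ¬¬P ¬∀ = ¬¬P fzero λ P₀ → ¬¬-∀-Fin n (λ i → ¬¬P (fsuc i)) λ Pₛ →
  ¬∀ λ where
    fzero    → P₀
    (fsuc i) → Pₛ i

⊆-last : ∀ {a p} {A : Set a} k (H : Fin (suc k) → Pred A p) →
         (∀ j → H (inject₁ j) ⊆ H (fsuc j)) → ∀ j → H j ⊆ H (fromℕ k)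
⊆-last zero    H step fzero    h = h
⊆-last (suc k) H step fzero    h = ⊆-last k (λ j → H (fsuc j)) (λ j → step (fsuc j)) fzero
                                            (step fzero h)
⊆-last (suc k) H step (fsuc j) h = ⊆-last k (λ j → H (fsuc j)) (λ j → step (fsuc j)) j h

module _ {a} {A : Set a} {k : ℕ} (H : Fin (suc k) → A) (T : A) where

  snoc : Fin (suc (suc k)) → A
  snoc i with view i
  ... | ‵fromℕ     = T
  ... | ‵inject₁ j = H j

  snoc-inject₁ : ∀ j → snoc (inject₁ j) ≡ H j
  snoc-inject₁ j rewrite view-inject₁ j = ≡.refl

  snoc-fromℕ : snoc (fromℕ (suc k)) ≡ T
  snoc-fromℕ rewrite view-fromℕ (suc k) = ≡.refl

  snoc-elim : ∀ {r} (P : A → Set r) → (∀ j → P (H j)) → P T → ∀ i → P (snoc i)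
  snoc-elim P PH PT i = go (view i)
    where
    go : ∀ {i} → View i → P (snoc i)
    go ‵fromℕ       = ≡.subst P (≡.sym snoc-fromℕ) PT
    go (‵inject₁ j) = ≡.subst P (≡.sym (snoc-inject₁ j)) (PH j)

  snoc-step : ∀ {r} (R : A → A → Set r) → (∀ j → R (H (inject₁ j)) (H (fsuc j))) →
              R (H (fromℕ k)) T → ∀ j → R (snoc (inject₁ j)) (snoc (fsuc j))
  snoc-step R step last j = go (view j)
    where
    go : ∀ {j} → View j → R (snoc (inject₁ j)) (snoc (fsuc j))
    go ‵fromℕ        = ≡.subst₂ R (≡.sym (snoc-inject₁ (fromℕ k))) (≡.sym snoc-fromℕ) last
    go (‵inject₁ j′) =
      ≡.subst₂ R (≡.sym (snoc-inject₁ (inject₁ j′))) (≡.sym (snoc-inject₁ (fsuc j′))) (step j′)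

-- Powers and subgroups of an abelian group

module _ {c ℓ} (G : AbelianGroup c ℓ) where
  open AbelianGroup G
  open import Algebra.Properties.AbelianGroup G
    using (inverseˡ-unique; inverseʳ-unique; identityʳ-unique; x≈z//y; ⁻¹-anti-homo‿-;
           //-rightDividesˡ; //-rightDividesʳ; \\-leftDividesʳ)
  open import Algebra.Properties.CommutativeMonoid.Mult commutativeMonoid
    renaming (_×_ to _·_) using (×-congʳ; ×-homo-+; ×-homo-1; ×-assocˡ; ×-distrib-+)
  open import Relation.Binary.Reasoning.Setoid setoid

  infixr 8 _^_
  _^_ : Carrier → ℕ → Carrier
  x ^ n = n · x

  powℕ≡^ : ∀ x n → powℕ G x n ≡ x ^ n
  powℕ≡^ x zero    = ≡.refl
  powℕ≡^ x (suc n) = ≡.cong (x ∙_) (powℕ≡^ x n)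

  ^-cong : ∀ {x y} n → x ≈ y → x ^ n ≈ y ^ n
  ^-cong n = ×-congʳ n

  ^-+ : ∀ x m n → x ^ (m + n) ≈ x ^ m ∙ x ^ n
  ^-+ = ×-homo-+

  ^-* : ∀ x m n → x ^ (m * n) ≈ (x ^ n) ^ m
  ^-* x m n = sym (×-assocˡ x m n)

  ^-1 : ∀ x → x ^ 1 ≈ x
  ^-1 = ×-homo-1

  ^-distrib-∙ : ∀ x y n → (x ∙ y) ^ n ≈ x ^ n ∙ y ^ n
  ^-distrib-∙ = ×-distrib-+

  ε-^ : ∀ n → ε ^ n ≈ ε
  ε-^ zero    = refl
  ε-^ (suc n) = trans (identityˡ _) (ε-^ n)

  ^-⁻¹ : ∀ x n → (x ⁻¹) ^ n ≈ (x ^ n) ⁻¹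
  ^-⁻¹ x n = inverseʳ-unique (x ^ n) ((x ⁻¹) ^ n) (begin
    x ^ n ∙ (x ⁻¹) ^ n ≈⟨ ^-distrib-∙ x (x ⁻¹) n ⟨
    (x ∙ x ⁻¹) ^ n     ≈⟨ ^-cong n (inverseʳ x) ⟩
    ε ^ n              ≈⟨ ε-^ n ⟩
    ε                  ∎)

  ^-quotient : ∀ a b n → (a ∙ b ⁻¹) ^ n ≈ a ^ n ∙ (b ^ n) ⁻¹
  ^-quotient a b n = trans (^-distrib-∙ a (b ⁻¹) n) (∙-congˡ (^-⁻¹ b n))

  ^∙^[*n]≈ε : ∀ {x} n b → x ^ suc n ≈ ε → x ^ b ∙ x ^ (b * n) ≈ ε
  ^∙^[*n]≈ε {x} n b xⁿ⁺¹≈ε = begin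
    x ^ b ∙ x ^ (b * n) ≈⟨ ^-+ x b (b * n) ⟨
    x ^ (b + b * n)     ≡⟨ ≡.cong (x ^_) (*-suc b n) ⟨
    x ^ (b * suc n)     ≈⟨ ^-* x b (suc n) ⟩
    (x ^ suc n) ^ b     ≈⟨ ^-cong b xⁿ⁺¹≈ε ⟩
    ε ^ b               ≈⟨ ε-^ b ⟩
    ε                   ∎

  ⁻¹-^≈^ : ∀ {x} n b → x ^ suc n ≈ ε → (x ^ b) ⁻¹ ≈ x ^ (b * n)
  ⁻¹-^≈^ n b xⁿ⁺¹≈ε = sym (inverseʳ-unique _ _ (^∙^[*n]≈ε n b xⁿ⁺¹≈ε))

  ^-+-period : ∀ {x} k n → x ^ n ≈ ε → x ^ (k + n) ≈ x ^ k
  ^-+-period {x} k n xⁿ≈ε = trans (^-+ x k n) (trans (∙-congˡ xⁿ≈ε) (identityʳ _))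

  minimal-period-∣ : ∀ {x} m → x ^ suc m ≈ ε → (∀ k → k < m → ¬ x ^ suc k ≈ ε) →
                     ∀ j → x ^ j ≈ ε → suc m ∣ j
  minimal-period-∣ {x} m xⁿ≈ε minimal j xʲ≈ε with j % suc m in j%n≡r
  ... | zero  = m%n≡0⇒n∣m j (suc m) j%n≡r
  ... | suc r = ⊥-elim (minimal r (≤-pred (≡.subst (_< suc m) j%n≡r (m%n<n j (suc m))))
                                  (≡.subst (λ t → x ^ t ≈ ε) j%n≡r x^[j%n]≈ε))
    where
    n = suc m
    x^[j%n]≈ε : x ^ (j % n) ≈ ε
    x^[j%n]≈ε = begin
      x ^ (j % n)                     ≈⟨ identityʳ _ ⟨
      x ^ (j % n) ∙ ε                 ≈⟨ ∙-congˡ (trans (^-cong (j / n) xⁿ≈ε) (ε-^ (j / n))) ⟨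
      x ^ (j % n) ∙ (x ^ n) ^ (j / n) ≈⟨ ∙-congˡ (^-* x (j / n) n) ⟨
      x ^ (j % n) ∙ x ^ (j / n * n)   ≈⟨ ^-+ x (j % n) (j / n * n) ⟨
      x ^ (j % n + j / n * n)         ≡⟨ ≡.cong (x ^_) (m≡m%n+[m/n]*n j n) ⟨
      x ^ j                           ≈⟨ xʲ≈ε ⟩
      ε                               ∎

  IsOrder : Carrier → ℕ → Set ℓ
  IsOrder x n = x ^ n ≈ ε × (∀ j → x ^ j ≈ ε → n ∣ j)

  -- Lifted to the level of IsSubgroup; in a finite group it coincides with ⟨ x ⟩.
  Powers : Carrier → Pred Carrier (c ⊔ ℓ)
  Powers x y = Lift c (∃ λ m → y ≈ x ^ m)

  Powers-^ : ∀ x m → Powers x (x ^ m)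
  Powers-^ x m = lift (m , refl)

  Powers-self : ∀ x → Powers x x
  Powers-self x = lift (1 , sym (^-1 x))

  module _ {K : Pred Carrier (c ⊔ ℓ)} (K≤G : IsSubgroup G K) where
    open IsSubgroup K≤G

    ^-closed : ∀ {w} n → K w → K (w ^ n)
    ^-closed zero    _  = ε∈
    ^-closed (suc n) Kw = ∙-closed Kw (^-closed n Kw)

    private
      closed-from : ∀ {w a b} r s → 1 + s * b ≡ r * a → K (w ^ a) → K (w ^ b) → K w
      closed-from {w} {a} {b} r s eq Kwᵃ Kwᵇ =
        resp (sym w≈) (∙-closed (^-closed r Kwᵃ) (⁻¹-closed (^-closed s Kwᵇ)))
        where
        w≈ : w ≈ (w ^ a) ^ r ∙ ((w ^ b) ^ s) ⁻¹
        w≈ = x≈z//y w ((w ^ b) ^ s) _ (begin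
          w ∙ (w ^ b) ^ s ≈⟨ ∙-congˡ (^-* w s b) ⟨
          w ^ (1 + s * b) ≡⟨ ≡.cong (w ^_) eq ⟩
          w ^ (r * a)     ≈⟨ ^-* w r a ⟩
          (w ^ a) ^ r     ∎)

    closed-by-productʳ : ∀ {a b} → K a → K (a ∙ b) → K b
    closed-by-productʳ {a} {b} Ka Kab = resp (\\-leftDividesʳ a b) (∙-closed (⁻¹-closed Ka) Kab)

    closed-by-quotientˡ : ∀ {a b} → K b → K (a ∙ b ⁻¹) → K a
    closed-by-quotientˡ {a} {b} Kb Ka/b = resp (//-rightDividesˡ b a) (∙-closed Ka/b Kb)

    closed-by-quotientʳ : ∀ {a b} → K a → K (a ∙ b ⁻¹) → K b
    closed-by-quotientʳ {a} {b} Ka Ka/b = resp b≈ (∙-closed (⁻¹-closed Ka/b) Ka)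
      where
      b≈ : (a ∙ b ⁻¹) ⁻¹ ∙ a ≈ b
      b≈ = trans (∙-congʳ (⁻¹-anti-homo‿- a b)) (//-rightDividesˡ a b)

    coprime-powers-closed : ∀ {w p a} → Prime p → ¬ p ∣ a → K (w ^ p) → K (w ^ a) → K w
    coprime-powers-closed pp p∤a Kwᵖ Kwᵃ with coprime-Bézout (prime∤⇒coprime pp p∤a)
    ... | Bézout.+- r s eq = closed-from r s eq Kwᵖ Kwᵃ
    ... | Bézout.-+ r s eq = closed-from s r eq Kwᵃ Kwᵖ

  -- Composition series

  _⋖_ : Pred Carrier (c ⊔ ℓ) → Pred Carrier (c ⊔ ℓ) → Set (lsuc (c ⊔ ℓ))
  A ⋖ B = _⊂_ G A B × (∀ K → IsSubgroup G K → ¬ (_⊂_ G A K × _⊂_ G K B))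

  module _ {x k} (S : CompositionSeries G x k) where
    open CompositionSeries S

    step-⋖ : ∀ j → H (inject₁ j) ⋖ H (fsuc j)
    step-⋖ j = proper j , maximal j

    H⊆⟨x⟩ : ∀ j → H j ⊆ ⟨_⟩ G x
    H⊆⟨x⟩ j h = proj₁ top (⊆-last k H (λ j → proj₁ (proper j)) j h)

    series-snoc : ∀ {w T} → IsSubgroup G T → _≐_ G T (⟨_⟩ G w) → H (fromℕ k) ⋖ T →
                  CompositionSeries G w (suc k)
    series-snoc {w} {T} T≤G T≐⟨w⟩ top⋖T = record
      { H        = snoc H T
      ; subgroup = snoc-elim H T (IsSubgroup G) subgroup T≤G
      ; bottom   = ≡.subst (λ B → _≐_ G B (Trivial G)) (≡.sym (snoc-inject₁ H T fzero)) bottom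
      ; top      = ≡.subst (λ B → _≐_ G B (⟨_⟩ G w)) (≡.sym (snoc-fromℕ H T)) T≐⟨w⟩
      ; proper   = λ j → proj₁ (steps j)
      ; maximal  = λ j → proj₂ (steps j)
      }
      where
      steps : ∀ j → snoc H T (inject₁ j) ⋖ snoc H T (fsuc j)
      steps = snoc-step H T _⋖_ step-⋖ top⋖T

  PowerMap : Carrier → Carrier → Set ℓ
  PowerMap x y = ∀ a b → x ^ a ≈ x ^ b → y ^ a ≈ y ^ b

  transport : Carrier → Carrier → Pred Carrier (c ⊔ ℓ) → Pred Carrier (c ⊔ ℓ)
  transport x y A v = ∃ λ m → v ≈ y ^ m × A (x ^ m)

  transport-mono : ∀ {x y A B} → A ⊆ B → transport x y A ⊆ transport x y B
  transport-mono A⊆B (m , v≈yᵐ , Axᵐ) = m , v≈yᵐ , A⊆B Axᵐ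

  transport-reflect : ∀ {x y A} → PowerMap y x → (∀ {a b} → a ≈ b → A a → A b) →
                      ∀ m → transport x y A (y ^ m) → A (x ^ m)
  transport-reflect y→x respA m (a , yᵐ≈yᵃ , Axᵃ) = respA (sym (y→x m a yᵐ≈yᵃ)) Axᵃ

  -- Finite abelian groups

  module _ (fin : IsFinite G) where
    private
      E = proj₁ fin
      enum = proj₁ (proj₂ fin)
      index : Carrier → Fin E
      index y = proj₁ (proj₂ (proj₂ fin) y)
      enum-index : ∀ y → enum (index y) ≈ y
      enum-index y = proj₂ (proj₂ (proj₂ fin) y)

    period : ∀ x → ∃ λ n → x ^ suc n ≈ ε
    period x with pigeonhole (n<1+n E) (λ i → index (x ^ toℕ i))
    ... | i , j , i<j , same-index with m≤n⇒∃[o]m+o≡n i<j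
    ... | o , i+1+o≡j = o , identityʳ-unique (x ^ toℕ i) (x ^ suc o) (begin
      x ^ toℕ i ∙ x ^ suc o        ≈⟨ ^-+ x (toℕ i) (suc o) ⟨
      x ^ (toℕ i + suc o)          ≡⟨ ≡.cong (x ^_) (≡.trans (+-suc (toℕ i) o) i+1+o≡j) ⟩
      x ^ toℕ j                    ≈⟨ enum-index (x ^ toℕ j) ⟨
      enum (index (x ^ toℕ j))     ≡⟨ ≡.cong enum same-index ⟨
      enum (index (x ^ toℕ i))     ≈⟨ enum-index (x ^ toℕ i) ⟩
      x ^ toℕ i                    ∎)

    Powers≤G : ∀ x → IsSubgroup G (Powers x)
    Powers≤G x = record
      { resp      = λ { y≈z (lift (m , y≈xᵐ)) → lift (m , trans (sym y≈z) y≈xᵐ) }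
      ; ε∈        = lift (0 , refl)
      ; ∙-closed  = λ { (lift (a , y≈xᵃ)) (lift (b , z≈xᵇ)) →
                        lift (a + b , trans (∙-cong y≈xᵃ z≈xᵇ) (sym (^-+ x a b))) }
      ; ⁻¹-closed = λ { (lift (a , y≈xᵃ)) →
                        lift (a * n , trans (⁻¹-cong y≈xᵃ) (⁻¹-^≈^ n a (proj₂ (period x)))) }
      }
      where n = proj₁ (period x)

    ⟨⟩⊆Powers : ∀ x → ⟨_⟩ G x ⊆ Powers x
    ⟨⟩⊆Powers x (+ m , y≈xᵐ) = lift (m , trans y≈xᵐ (reflexive (powℕ≡^ x m)))
    ⟨⟩⊆Powers x (-[1+ m ] , y≈x⁻ᵐ) =
      IsSubgroup.resp (Powers≤G x) (sym y≈x⁻ᵐ)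
        (IsSubgroup.⁻¹-closed (Powers≤G x) (lift (suc m , reflexive (powℕ≡^ x (suc m)))))

    Powers⊆⟨⟩ : ∀ x → Powers x ⊆ ⟨_⟩ G x
    Powers⊆⟨⟩ x (lift (m , y≈xᵐ)) = + m , trans y≈xᵐ (sym (reflexive (powℕ≡^ x m)))

    ¬¬-order : ∀ x → ¬ ¬ ∃ (IsOrder x)
    ¬¬-order x ¬order =
      ¬¬-least (λ m → x ^ suc m ≈ ε) (<-wellFounded (proj₁ (period x))) (proj₂ (period x))
        λ (m , xᵐ⁺¹≈ε , minimal) →
          ¬order (suc m , xᵐ⁺¹≈ε , minimal-period-∣ m xᵐ⁺¹≈ε minimal)

    ¬¬-cyclic : ∀ {x} → (∀ z → ¬ ¬ Powers x z) → ¬ ¬ IsCyclic G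
    ¬¬-cyclic {x} ¬¬Powers ¬cyclic = ¬¬-∀-Fin E (λ i → ¬¬Powers (enum i)) λ Powers-enum →
      ¬cyclic (x , λ y →
        Powers⊆⟨⟩ x (IsSubgroup.resp (Powers≤G x) (enum-index y) (Powers-enum (index y))))

    annihilator⇒PowerMap : ∀ {x y} → (∀ j → x ^ j ≈ ε → y ^ j ≈ ε) → PowerMap x y
    annihilator⇒PowerMap {x} {y} ann a b xᵃ≈xᵇ =
      trans (inverseˡ-unique _ _ (y^-+ a xᵃ≈xᵇ)) (sym (inverseˡ-unique _ _ (y^-+ b refl)))
      where
      n = proj₁ (period x)
      xᵇ∙xᵇⁿ≈ε : x ^ b ∙ x ^ (b * n) ≈ ε
      xᵇ∙xᵇⁿ≈ε = ^∙^[*n]≈ε n b (proj₂ (period x))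
      y^-+ : ∀ c → x ^ c ≈ x ^ b → y ^ c ∙ y ^ (b * n) ≈ ε
      y^-+ c xᶜ≈xᵇ = trans (sym (^-+ y c (b * n)))
        (ann (c + b * n) (trans (^-+ x c (b * n)) (trans (∙-congʳ xᶜ≈xᵇ) xᵇ∙xᵇⁿ≈ε)))

    transport-isSubgroup : ∀ {x y A} → PowerMap x y → IsSubgroup G A → IsSubgroup G (transport x y A)
    transport-isSubgroup {x} {y} {A} x→y A≤G = record
      { resp      = λ { v≈w (m , v≈yᵐ , Axᵐ) → m , trans (sym v≈w) v≈yᵐ , Axᵐ }
      ; ε∈        = 0 , refl , ε∈
      ; ∙-closed  = λ { (a , v≈yᵃ , Axᵃ) (b , w≈yᵇ , Axᵇ) →
                        a + b , trans (∙-cong v≈yᵃ w≈yᵇ) (sym (^-+ y a b)) ,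
                        resp (sym (^-+ x a b)) (∙-closed Axᵃ Axᵇ) }
      ; ⁻¹-closed = λ { (a , v≈yᵃ , Axᵃ) →
                        a * n , trans (⁻¹-cong v≈yᵃ) (⁻¹-^≈^ n a yⁿ⁺¹≈ε) ,
                        resp (⁻¹-^≈^ n a xⁿ⁺¹≈ε) (⁻¹-closed Axᵃ) }
      }
      where
      open IsSubgroup A≤G
      n = proj₁ (period x)
      xⁿ⁺¹≈ε = proj₂ (period x)
      yⁿ⁺¹≈ε = x→y (suc n) 0 xⁿ⁺¹≈ε

    module _ {x y} (x→y : PowerMap x y) (y→x : PowerMap y x) where

      transport-⋖ : ∀ {A B} → IsSubgroup G A → IsSubgroup G B → B ⊆ Powers x → A ⋖ B →
                    transport x y A ⋖ transport x y B
      transport-⋖ {A} {B} A≤G B≤G B⊆xᴺ ((A⊆B , b , Bb , ¬Ab) , A⋖B) = tA⊂tB , nothing-between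
        where
        respA = IsSubgroup.resp A≤G
        respB = IsSubgroup.resp B≤G

        tA⊂tB : _⊂_ G (transport x y A) (transport x y B)
        tA⊂tB with lower (B⊆xᴺ Bb)
        ... | m , b≈xᵐ = transport-mono {x} {y} {A} {B} A⊆B , y ^ m , (m , refl , respB b≈xᵐ Bb) ,
          λ tAyᵐ → ¬Ab (respA (sym b≈xᵐ) (transport-reflect y→x respA m tAyᵐ))

        nothing-between : ∀ K → IsSubgroup G K →
                          ¬ (_⊂_ G (transport x y A) K × _⊂_ G K (transport x y B))
        nothing-between K K≤G ((tA⊆K , v , Kv , ¬tAv) , (K⊆tB , u , tBu , ¬Ku)) =
          A⋖B K′ (transport-isSubgroup y→x K≤G) (A⊂K′ , K′⊂B)
          where
          respK = IsSubgroup.resp K≤G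
          K′ = transport y x K

          A⊂K′ : _⊂_ G A K′
          A⊂K′ = (λ Aa → let (j , a≈xʲ) = lower (B⊆xᴺ (A⊆B Aa)) in
                           j , a≈xʲ , tA⊆K (j , refl , respA a≈xʲ Aa))
               , (let (j , v≈yʲ , _) = K⊆tB Kv in
                  x ^ j , (j , refl , respK v≈yʲ Kv) , λ Axʲ → ¬tAv (j , v≈yʲ , Axʲ))

          K′⊂B : _⊂_ G K′ B
          K′⊂B = (λ (j , w≈xʲ , Kyʲ) →
                    respB (sym w≈xʲ) (transport-reflect y→x respB j (K⊆tB Kyʲ)))
               , (let (j , u≈yʲ , Bxʲ) = tBu in
                  x ^ j , Bxʲ , λ (i , xʲ≈xⁱ , Kyⁱ) →
                    ¬Ku (respK (sym (trans u≈yʲ (x→y j i xʲ≈xⁱ))) Kyⁱ))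

      transport-series : ∀ {i} → CompositionSeries G x i → CompositionSeries G y i
      transport-series S = record
        { H        = λ j → transport x y (H j)
        ; subgroup = λ j → transport-isSubgroup x→y (subgroup j)
        ; bottom   = (λ (m , v≈yᵐ , H₀xᵐ) → trans v≈yᵐ (x→y m 0 (proj₁ bottom H₀xᵐ)))
                   , (λ v≈ε → 0 , v≈ε , proj₂ bottom refl)
        ; top      = (λ (m , v≈yᵐ , _) → Powers⊆⟨⟩ y (lift (m , v≈yᵐ)))
                   , (λ ⟨y⟩v → let (m , v≈yᵐ) = lower (⟨⟩⊆Powers y ⟨y⟩v) in
                       m , v≈yᵐ , proj₂ top (Powers⊆⟨⟩ x (Powers-^ x m)))
        ; proper   = λ j → proj₁ (step j)
        ; maximal  = λ j → proj₂ (step j)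
        }
        where
        open CompositionSeries S
        step : ∀ j → transport x y (H (inject₁ j)) ⋖ transport x y (H (fsuc j))
        step j = transport-⋖ (subgroup (inject₁ j)) (subgroup (fsuc j))
                   (λ h → ⟨⟩⊆Powers x (H⊆⟨x⟩ S (fsuc j) h)) (step-⋖ S j)

    prime-root-⋖ : ∀ {x w p A} → Prime p → w ^ p ≈ x → ¬ Powers x w → _≐_ G A (⟨_⟩ G x) →
                   A ⋖ Powers w
    prime-root-⋖ {x} {w} {p} {A} pp wᵖ≈x w∉xᴺ (A⊆⟨x⟩ , ⟨x⟩⊆A) =
      (A⊆wᴺ , w , Powers-self w , λ Aw → w∉xᴺ (A⊆xᴺ Aw)) ,
      λ K K≤G ((A⊆K , v , Kv , ¬Av) , (K⊆wᴺ , u , lift (j , u≈wʲ) , ¬Ku)) →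
        let open IsSubgroup K≤G
            (m , v≈wᵐ) = lower (K⊆wᴺ Kv)
            p∤m : ¬ p ∣ m
            p∤m (divides q m≡qp) = ¬Av (⟨x⟩⊆A (Powers⊆⟨⟩ x (lift (q , x^-multiple q v≈wᵐ m≡qp))))
            Kwᵖ = resp (sym wᵖ≈x) (A⊆K (⟨x⟩⊆A (Powers⊆⟨⟩ x (Powers-self x))))
            Kw = coprime-powers-closed K≤G pp p∤m Kwᵖ (resp v≈wᵐ Kv)
        in ¬Ku (resp (sym u≈wʲ) (^-closed K≤G j Kw))
      where
      A⊆xᴺ : A ⊆ Powers x
      A⊆xᴺ a = ⟨⟩⊆Powers x (A⊆⟨x⟩ a)
      x^-multiple : ∀ {v m} q → v ≈ w ^ m → m ≡ q * p → v ≈ x ^ q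
      x^-multiple {v} {m} q v≈wᵐ m≡qp = begin
        v           ≈⟨ v≈wᵐ ⟩
        w ^ m       ≡⟨ ≡.cong (w ^_) m≡qp ⟩
        w ^ (q * p) ≈⟨ ^-* w q p ⟩
        (w ^ p) ^ q ≈⟨ ^-cong q wᵖ≈x ⟩
        x ^ q       ∎
      A⊆wᴺ : A ⊆ Powers w
      A⊆wᴺ a = let (q , a≈xᑫ) = lower (A⊆xᴺ a) in
        lift (q * p , trans a≈xᑫ (sym (x^-multiple q refl ≡.refl)))

    series-prime-root : ∀ {x w p i} → CompositionSeries G x i → Prime p → w ^ p ≈ x →
                        ¬ Powers x w → CompositionSeries G w (suc i)
    series-prime-root {w = w} S pp wᵖ≈x w∉xᴺ =
      series-snoc S (Powers≤G w) (Powers⊆⟨⟩ w , ⟨⟩⊆Powers w)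
        (prime-root-⋖ pp wᵖ≈x w∉xᴺ (CompositionSeries.top S))

    ¬¬-prime-step : ∀ {x z} → ¬ Powers x z →
                    ¬ ¬ ∃ λ w → ∃ λ p → Prime p × ¬ Powers x w × Powers x (w ^ p)
    ¬¬-prime-step {x} {z} z∉xᴺ = descend (factors f) (factorsPrime f)
      (≡.subst (λ m → Powers x (z ^ m)) (isFactorisation f) (lift (0 , proj₂ (period z))))
      where
      open PrimeFactorisation
      f = factorise (suc (proj₁ (period z)))
      descend : ∀ ps → All Prime ps → Powers x (z ^ product ps) →
                ¬ ¬ ∃ λ w → ∃ λ p → Prime p × ¬ Powers x w × Powers x (w ^ p)
      descend []       []          z¹∈xᴺ  _ = z∉xᴺ (IsSubgroup.resp (Powers≤G x) (^-1 z) z¹∈xᴺ)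
      descend (p ∷ ps) (pp ∷ pps) zᵖᴾ∈xᴺ k =
        ¬¬-excluded-middle {A = Powers x (z ^ product ps)} λ where
        (yes zᴾ∈xᴺ) → descend ps pps zᴾ∈xᴺ k
        (no zᴾ∉xᴺ)  → k (z ^ product ps , p , pp , zᴾ∉xᴺ ,
                         IsSubgroup.resp (Powers≤G x) (^-* z p (product ps)) zᵖᴾ∈xᴺ)

    prime-root : ∀ {x w p k} → Prime p → ¬ p ∣ k → ¬ Powers x w → w ^ p ≈ x ^ k →
                 ∃ λ v → v ^ p ≈ x × ¬ Powers x v
    prime-root {x} {w} {p} {k} pp p∤k w∉xᴺ wᵖ≈xᵏ =
      root (coprime-Bézout (prime∤⇒coprime pp p∤k))
      where
      xʳᵖ≈ : ∀ r → (x ^ r) ^ p ≈ x ^ (r * p)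
      xʳᵖ≈ r = trans (sym (^-* x p r)) (reflexive (≡.cong (x ^_) (*-comm p r)))
      wˢᵖ≈ : ∀ s → (w ^ s) ^ p ≈ x ^ (s * k)
      wˢᵖ≈ s = begin
        (w ^ s) ^ p ≈⟨ ^-* w p s ⟨
        w ^ (p * s) ≡⟨ ≡.cong (w ^_) (*-comm p s) ⟩
        w ^ (s * p) ≈⟨ ^-* w s p ⟩
        (w ^ p) ^ s ≈⟨ ^-cong s wᵖ≈xᵏ ⟩
        (x ^ k) ^ s ≈⟨ ^-* x s k ⟨
        x ^ (s * k) ∎
      wˢ∉ : ∀ s → ¬ p ∣ s → ¬ Powers x (w ^ s)
      wˢ∉ s p∤s wˢ∈xᴺ =
        w∉xᴺ (coprime-powers-closed (Powers≤G x) pp p∤s (lift (k , wᵖ≈xᵏ)) wˢ∈xᴺ)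
      root : Bézout.Identity 1 p k → ∃ λ v → v ^ p ≈ x × ¬ Powers x v
      root (Bézout.+- r s 1+sk≡rp) = x ^ r ∙ (w ^ s) ⁻¹ , (begin
        (x ^ r ∙ (w ^ s) ⁻¹) ^ p           ≈⟨ ^-quotient (x ^ r) (w ^ s) p ⟩
        (x ^ r) ^ p ∙ ((w ^ s) ^ p) ⁻¹     ≈⟨ ∙-cong (xʳᵖ≈ r) (⁻¹-cong (wˢᵖ≈ s)) ⟩
        x ^ (r * p) ∙ (x ^ (s * k)) ⁻¹     ≡⟨ ≡.cong (λ m → x ^ m ∙ (x ^ (s * k)) ⁻¹) 1+sk≡rp ⟨
        x ^ (1 + s * k) ∙ (x ^ (s * k)) ⁻¹ ≈⟨ //-rightDividesʳ (x ^ (s * k)) x ⟩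
        x                                  ∎) ,
        λ v∈xᴺ → wˢ∉ s (λ p∣s → prime∤1+ pp (∣-trans p∣s (m∣m*n k)) (n∣m*n r) 1+sk≡rp)
                     (closed-by-quotientʳ (Powers≤G x) (Powers-^ x r) v∈xᴺ)
      root (Bézout.-+ r s 1+rp≡sk) = w ^ s ∙ (x ^ r) ⁻¹ , (begin
        (w ^ s ∙ (x ^ r) ⁻¹) ^ p           ≈⟨ ^-quotient (w ^ s) (x ^ r) p ⟩
        (w ^ s) ^ p ∙ ((x ^ r) ^ p) ⁻¹     ≈⟨ ∙-cong (wˢᵖ≈ s) (⁻¹-cong (xʳᵖ≈ r)) ⟩
        x ^ (s * k) ∙ (x ^ (r * p)) ⁻¹     ≡⟨ ≡.cong (λ m → x ^ m ∙ (x ^ (r * p)) ⁻¹) 1+rp≡sk ⟨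
        x ^ (1 + r * p) ∙ (x ^ (r * p)) ⁻¹ ≈⟨ //-rightDividesʳ (x ^ (r * p)) x ⟩
        x                                  ∎) ,
        λ v∈xᴺ → wˢ∉ s (λ p∣s → prime∤1+ pp (n∣m*n r) (∣-trans p∣s (m∣m*n k)) 1+rp≡sk)
                     (closed-by-quotientˡ (Powers≤G x) (Powers-^ x r) v∈xᴺ)

    -- y = x u has the annihilator of x, hence the composition length of x, but ⟨x⟩ and ⟨y⟩
    -- are incomparable.
    module Twin {x u p n} (order : IsOrder x n) (pp : Prime p) (p∣n : p ∣ n)
                (uᵖ≈ε : u ^ p ≈ ε) (u∉xᴺ : ¬ Powers x u) where

      y : Carrier
      y = x ∙ u

      uʲ≈ε : ∀ {j} → p ∣ j → u ^ j ≈ ε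
      uʲ≈ε {j} (divides q j≡qp) = begin
        u ^ j       ≡⟨ ≡.cong (u ^_) j≡qp ⟩
        u ^ (q * p) ≈⟨ ^-* u q p ⟩
        (u ^ p) ^ q ≈⟨ ^-cong q uᵖ≈ε ⟩
        ε ^ q       ≈⟨ ε-^ q ⟩
        ε           ∎

      p∣j : ∀ j → Powers x (u ^ j) → p ∣ j
      p∣j j uʲ∈xᴺ with p ∣? j
      ... | yes p∣j = p∣j
      ... | no  p∤j =
        ⊥-elim (u∉xᴺ (coprime-powers-closed (Powers≤G x) pp p∤j (lift (0 , uᵖ≈ε)) uʲ∈xᴺ))

      ¬x≈xʲ : ∀ j → p ∣ j → ¬ x ≈ x ^ j
      ¬x≈xʲ zero     _   x≈ε  = prime∤1 pp (∣-trans p∣n (proj₂ order 1 (trans (^-1 x) x≈ε)))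
      ¬x≈xʲ (suc j) p∣1+j x≈xxʲ = prime∤1+ pp (∣-trans p∣n (proj₂ order j xʲ≈ε)) p∣1+j ≡.refl
        where
        xʲ≈ε : x ^ j ≈ ε
        xʲ≈ε = identityʳ-unique x (x ^ j) (sym x≈xxʲ)

      yʲ≈ : ∀ j → y ^ j ≈ x ^ j ∙ u ^ j
      yʲ≈ = ^-distrib-∙ x u

      x→y : PowerMap x y
      x→y = annihilator⇒PowerMap λ j xʲ≈ε → begin
        y ^ j         ≈⟨ yʲ≈ j ⟩
        x ^ j ∙ u ^ j ≈⟨ ∙-cong xʲ≈ε (uʲ≈ε (∣-trans p∣n (proj₂ order j xʲ≈ε))) ⟩
        ε ∙ ε         ≈⟨ identityˡ ε ⟩
        ε             ∎

      y→x : PowerMap y x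
      y→x = annihilator⇒PowerMap λ j yʲ≈ε →
        let xʲuʲ≈ε = trans (sym (yʲ≈ j)) yʲ≈ε
            uʲ∈xᴺ  = closed-by-productʳ (Powers≤G x) (Powers-^ x j)
                       (IsSubgroup.resp (Powers≤G x) (sym xʲuʲ≈ε) (Powers-^ x 0))
        in trans (sym (identityʳ _)) (trans (∙-congˡ (sym (uʲ≈ε (p∣j j uʲ∈xᴺ)))) xʲuʲ≈ε)

      x≉y : ¬ x ≈ y
      x≉y x≈xu = u∉xᴺ (lift (0 , identityʳ-unique x u (sym x≈xu)))

      ¬⟨x⟩⊆⟨y⟩ : ¬ ⟨_⟩ G x ⊆ ⟨_⟩ G y
      ¬⟨x⟩⊆⟨y⟩ ⟨x⟩⊆⟨y⟩ with lower (⟨⟩⊆Powers y (⟨x⟩⊆⟨y⟩ (Powers⊆⟨⟩ x (Powers-self x))))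
      ... | j , x≈yʲ = ¬x≈xʲ j p∣j′ (begin
        x             ≈⟨ x≈xʲuʲ ⟩
        x ^ j ∙ u ^ j ≈⟨ ∙-congˡ (uʲ≈ε p∣j′) ⟩
        x ^ j ∙ ε     ≈⟨ identityʳ _ ⟩
        x ^ j         ∎)
        where
        x≈xʲuʲ = trans x≈yʲ (yʲ≈ j)
        p∣j′ : p ∣ j
        p∣j′ = p∣j j (closed-by-productʳ (Powers≤G x) (Powers-^ x j)
                       (IsSubgroup.resp (Powers≤G x) x≈xʲuʲ (Powers-self x)))

      ¬⟨y⟩⊆⟨x⟩ : ¬ ⟨_⟩ G y ⊆ ⟨_⟩ G x
      ¬⟨y⟩⊆⟨x⟩ ⟨y⟩⊆⟨x⟩ = u∉xᴺ (closed-by-productʳ (Powers≤G x) (Powers-self x)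
        (⟨⟩⊆Powers x (⟨y⟩⊆⟨x⟩ (Powers⊆⟨⟩ y (Powers-self y)))))

      ¬adjacent : ¬ Adjacent G x y
      ¬adjacent (_ , inj₁ ⟨x⟩⊆⟨y⟩) = ¬⟨x⟩⊆⟨y⟩ ⟨x⟩⊆⟨y⟩
      ¬adjacent (_ , inj₂ ⟨y⟩⊆⟨x⟩) = ¬⟨y⟩⊆⟨x⟩ ⟨y⟩⊆⟨x⟩

    module _ {i₀ x} (S : CompositionSeries G x i₀)
             (i₀-maximal : ∀ j → i₀ < j → ∀ z → ¬ X G j z) (clique : IsClique G (X G i₀)) where

      no-prime-root : ∀ {p} → Prime p → ¬ ∃ λ v → v ^ p ≈ x × ¬ Powers x v
      no-prime-root pp (_ , vᵖ≈x , v∉xᴺ) =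
        i₀-maximal (suc i₀) ≤-refl _ (series-prime-root S pp vᵖ≈x v∉xᴺ)

      no-twin : ∀ {u p n} → IsOrder x n → Prime p → p ∣ n → u ^ p ≈ ε → ¬ Powers x u → ⊥
      no-twin order pp p∣n uᵖ≈ε u∉xᴺ =
        ¬adjacent (clique x y S (transport-series x→y y→x S) x≉y)
        where open Twin order pp p∣n uᵖ≈ε u∉xᴺ

      no-prime-step-to-multiple : ∀ {w p n} q → IsOrder x n → Prime p → p ∣ n → ¬ Powers x w →
                                  w ^ p ≈ x ^ (q * p) → ⊥
      no-prime-step-to-multiple {w} {p} q order pp p∣n w∉xᴺ wᵖ≈xᑫᵖ = no-twin order pp p∣n uᵖ≈ε
        (λ u∈xᴺ → w∉xᴺ (closed-by-quotientˡ (Powers≤G x) (Powers-^ x q) u∈xᴺ))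
        where
        uᵖ≈ε : (w ∙ (x ^ q) ⁻¹) ^ p ≈ ε
        uᵖ≈ε = begin
          (w ∙ (x ^ q) ⁻¹) ^ p       ≈⟨ ^-quotient w (x ^ q) p ⟩
          w ^ p ∙ ((x ^ q) ^ p) ⁻¹   ≈⟨ ∙-congʳ wᵖ≈xᑫᵖ ⟩
          x ^ (q * p) ∙ ((x ^ q) ^ p) ⁻¹ ≈⟨ ∙-congˡ (⁻¹-cong (^-* x p q)) ⟨
          x ^ (q * p) ∙ (x ^ (p * q)) ⁻¹ ≡⟨ ≡.cong (λ m → x ^ (q * p) ∙ (x ^ m) ⁻¹) (*-comm p q) ⟩
          x ^ (q * p) ∙ (x ^ (q * p)) ⁻¹ ≈⟨ inverseʳ _ ⟩
          ε                          ∎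

      -- One of k and k + n is prime to p unless p ∣ n.
      no-prime-step : ∀ {w p} → Prime p → ¬ Powers x w → Powers x (w ^ p) → ¬ ∃ (IsOrder x)
      no-prime-step {w} {p} pp w∉xᴺ (lift (k , wᵖ≈xᵏ)) (n , order) with p ∣? k | p ∣? (k + n)
      ... | no p∤k  | _          = no-prime-root pp (prime-root pp p∤k w∉xᴺ wᵖ≈xᵏ)
      ... | yes _   | no p∤k+n   = no-prime-root pp
        (prime-root pp p∤k+n w∉xᴺ (trans wᵖ≈xᵏ (sym (^-+-period k n (proj₁ order)))))
      ... | yes p∣k@(divides q k≡qp) | yes p∣k+n = no-prime-step-to-multiple q order pp
        (∣m+n∣m⇒∣n p∣k+n p∣k) w∉xᴺ (trans wᵖ≈xᵏ (reflexive (≡.cong (x ^_) k≡qp)))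

      generates : ∀ z → ¬ ¬ Powers x z
      generates z z∉xᴺ = ¬¬-prime-step z∉xᴺ λ (w , p , pp , w∉xᴺ , wᵖ∈xᴺ) →
        ¬¬-order x (no-prime-step pp w∉xᴺ wᵖ∈xᴺ)

proposition8 : ∀ {c ℓ : Level} (G : AbelianGroup c ℓ) → IsFinite G → ¬ IsCyclic G →
    (i₀ : ℕ) → (∃ λ x → X G i₀ x) → (∀ j → i₀ < j → ∀ x → ¬ X G j x) →
    ¬ IsClique G (X G i₀)
proposition8 G fin ¬cyclic i₀ (x , S) i₀-maximal clique =
  ¬¬-cyclic G fin (generates G fin S i₀-maximal clique) ¬cyclic
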